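{- On subfamilies of $\mathcal{P}\mathbb{N}$ (with the Scott topology), Wadge reducibility, finite-to-one Wadge reducibility and one-to-one Wadge reducibility are pairwise inequivalent relations. The same holds for their effective versions.
   Context: $\mathcal{P}\mathbb{N}$ is the powerset of $\mathbb{N}$ ordered by inclusion with the Scott topology, whose basic open families are $\mathcal{B}_A=\{X: A\subseteq X\}$, $A$ finite. $\mathcal{X}$ is (finite-to-one, one-to-one) Wadge reducible to $\mathcal{Y}$ if $\mathcal{X}=f^{ -1}(\mathcal{Y})$ for some continuous (resp. finite-to-one, one-to-one) $f:\mathcal{P}\mathbb{N}\to\mathcal{P}\mathbb{N}$. Effective versions require $f$ effective: $\{(A,B): f(\mathcal{B}_A)\subseteq\mathcal{B}_B\}$ computably enumerable. -}

module Defs where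

open import Data.Nat.Base using (ℕ; zero; suc; _<_; _/_)
open import Data.Nat.Base using (_%_; _≡ᵇ_)
open import Data.Bool.Base using (Bool; true; false)
open import Data.Fin.Base using (Fin)
open import Data.Vec.Base using (Vec; []; _∷_; lookup)
open import Data.List.Base using (List; [])
open import Data.List.Relation.Unary.Any using (Any)
open import Data.Product.Base using (Σ; _×_)
open import Function.Bundles using (_⇔_)
open import Relation.Binary.PropositionalEquality using (_≡_)
open import Relation.Nullary using (¬_)

Sub : Set
Sub = ℕ → Bool

_⊆_ : Sub → Sub → Set
X ⊆ Y = ∀ a → X a ≡ true → Y a ≡ true

_≐_ : Sub → Sub → Set
X ≐ Y = ∀ a → X a ≡ Y a

Family : Set₁
Family = Sub → Set

-- Finite sets via canonical indices: a ∈ D n iff bit a of n is 1.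

bit : ℕ → ℕ → Bool
bit n zero    = (n % 2) ≡ᵇ 1
bit n (suc a) = bit (n / 2) a

D : ℕ → Sub
D n = bit n

-- Basic Scott-open family 𝓑_A with A = D n : {X : A ⊆ X}
InB : ℕ → Sub → Set
InB n X = D n ⊆ X

-- Scott continuity: the preimage of every basic open 𝓑_B is open,
-- i.e. each point of it has a basic neighbourhood 𝓑_A inside it.

Continuous : (Sub → Sub) → Set
Continuous f = ∀ b X → InB b (f X) →
  Σ ℕ λ a → InB a X × (∀ Y → InB a Y → InB b (f Y))

MapsInto : (Sub → Sub) → ℕ → ℕ → Set
MapsInto f a b = ∀ Y → InB a Y → InB b (f Y)

FiniteToOne : (Sub → Sub) → Set
FiniteToOne f = ∀ T → Σ (List Sub) λ L → ∀ S → f S ≐ T → Any (S ≐_) L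

OneToOne : (Sub → Sub) → Set
OneToOne f = ∀ S S′ → f S ≐ f S′ → S ≐ S′

data PR : ℕ → Set where
  zer  : ∀ {n} → PR n
  succ : PR 1
  proj : ∀ {n} → Fin n → PR n
  comp : ∀ {m n} → PR m → Vec (PR n) m → PR n
  prec : ∀ {n} → PR n → PR (suc (suc n)) → PR (suc n)
  mu   : ∀ {n} → PR (suc n) → PR n

mutual
  data Eval : ∀ {n} → PR n → Vec ℕ n → ℕ → Set where
    e-zer   : ∀ {n} {xs : Vec ℕ n} → Eval zer xs 0
    e-succ  : ∀ {x} → Eval succ (x ∷ []) (suc x)
    e-proj  : ∀ {n} {i : Fin n} {xs} → Eval (proj i) xs (lookup xs i)
    e-comp  : ∀ {m n} {f : PR m} {gs : Vec (PR n) m} {xs ys v} →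
              EvalAll gs xs ys → Eval f ys v → Eval (comp f gs) xs v
    e-prec0 : ∀ {n} {g : PR n} {h xs v} →
              Eval g xs v → Eval (prec g h) (0 ∷ xs) v
    e-precS : ∀ {n} {g : PR n} {h k xs w v} →
              Eval (prec g h) (k ∷ xs) w → Eval h (k ∷ w ∷ xs) v →
              Eval (prec g h) (suc k ∷ xs) v
    e-mu    : ∀ {n} {f : PR (suc n)} {xs y} →
              Eval f (y ∷ xs) 0 →
              (∀ z → z < y → Σ ℕ λ w → Eval f (z ∷ xs) (suc w)) →
              Eval (mu f) xs y

  data EvalAll {n} : ∀ {m} → Vec (PR n) m → Vec ℕ n → Vec ℕ m → Set where
    []  : ∀ {xs} → EvalAll [] xs []
    _∷_ : ∀ {m g v xs} {gs : Vec (PR n) m} {vs} →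
          Eval g xs v → EvalAll gs xs vs → EvalAll (g ∷ gs) xs (v ∷ vs)

-- A binary relation on ℕ is c.e. iff it is the domain of a partial
-- recursive function.
CE2 : (ℕ → ℕ → Set) → Set
CE2 R = Σ (PR 2) λ e → ∀ a b → R a b ⇔ Σ ℕ (λ v → Eval e (a ∷ b ∷ []) v)

Effective : (Sub → Sub) → Set
Effective f = CE2 (MapsInto f)

Reduces : Family → Family → (Sub → Sub) → Set
Reduces 𝒳 𝒴 f = ∀ S → 𝒳 S ⇔ 𝒴 (f S)

_≤W_ : Family → Family → Set
𝒳 ≤W 𝒴 = Σ (Sub → Sub) λ f → Continuous f × Reduces 𝒳 𝒴 f

_≤FW_ : Family → Family → Set
𝒳 ≤FW 𝒴 = Σ (Sub → Sub) λ f → Continuous f × FiniteToOne f × Reduces 𝒳 𝒴 f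

_≤1W_ : Family → Family → Set
𝒳 ≤1W 𝒴 = Σ (Sub → Sub) λ f → Continuous f × OneToOne f × Reduces 𝒳 𝒴 f

_≤eW_ : Family → Family → Set
𝒳 ≤eW 𝒴 = Σ (Sub → Sub) λ f → Continuous f × Effective f × Reduces 𝒳 𝒴 f

_≤eFW_ : Family → Family → Set
𝒳 ≤eFW 𝒴 = Σ (Sub → Sub) λ f →
  Continuous f × Effective f × FiniteToOne f × Reduces 𝒳 𝒴 f

_≤e1W_ : Family → Family → Set
𝒳 ≤e1W 𝒴 = Σ (Sub → Sub) λ f →
  Continuous f × Effective f × OneToOne f × Reduces 𝒳 𝒴 f

Inequiv : (Family → Family → Set) → (Family → Family → Set) → Set₁
Inequiv R R′ = ¬ (∀ 𝒳 𝒴 → R 𝒳 𝒴 ⇔ R′ 𝒳 𝒴)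

module Submission where

-- Everything is witnessed with the target family IsFull = {ℕ}.  A reduction
-- f of 𝒳 to {ℕ} sends every member of 𝒳 to ℕ, so
--   * f is not one-to-one as soon as 𝒳 has two distinct members, and
--   * f is not finite-to-one as soon as 𝒳 is infinite (up to ≐).
-- The constant map with value ℕ reduces Everything = 𝒫ℕ to {ℕ}; it is
-- continuous and trivially effective, and 𝒫ℕ is infinite (Cantor's diagonal
-- argument), which separates ≤W from ≤FW and ≤1W.  The shift S ↦ S − 1
-- reduces ContainsPositives = {S : ℕ∖{0} ⊆ S} to {ℕ}; it is continuous and
-- two-to-one, which separates ≤FW from ≤1W.  For the effective versions it
-- remains to see that the shift is effective: f(𝓑_{D a}) ⊆ 𝓑_{D b} holds iff
-- D b ⊆ D (a / 2), and this is decided by a total partial recursive program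
-- (count the bits of b missing from a / 2); a relation decided by a total
-- program is c.e., by an unbounded search with μ.

open import Defs
open import Data.Product.Base using (_×_; _,_; Σ)
open import Data.Nat.Base using (ℕ; zero; suc; _+_; _<_; s≤s; z≤n; _/_)
open import Data.Nat.Properties using (m≤n⇒m<n∨m≡n; ≤-<-trans; <-cmp)
open import Data.Nat.DivMod using (m/n≡1+[m∸n]/n; m/n<m)
open import Data.Bool.Base using (Bool; true; false; not; _∧_)
open import Data.Fin.Base using () renaming (zero to f0; suc to fs)
open import Data.Vec.Base using (Vec; []; _∷_)
open import Data.List.Base using (List; []; _∷_)
open import Data.List.Relation.Unary.Any using (Any; here; there)
open import Data.Unit.Base using (⊤; tt)
open import Data.Sum.Base using (inj₁; inj₂)
open import Data.Empty using (⊥-elim)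
open import Function.Bundles using (_⇔_; mk⇔; Equivalence)
open import Function.Properties.Equivalence using () renaming (trans to ⇔-trans)
open import Relation.Binary.PropositionalEquality
  using (_≡_; _≢_; refl; sym; trans; cong; subst; module ≡-Reasoning)
open import Relation.Nullary using (¬_)
open import Relation.Binary.Definitions using (tri<; tri≈; tri>)

open ≡-Reasoning

inequiv : ∀ {R R′ : Family → Family → Set} 𝒳 𝒴 → R 𝒳 𝒴 → ¬ R′ 𝒳 𝒴 → Inequiv R R′
inequiv 𝒳 𝒴 r ¬r′ R⇔R′ = ¬r′ (Equivalence.to (R⇔R′ 𝒳 𝒴) r)

full : Sub
full _ = true

cons : Bool → Sub → Sub
cons b S zero    = b
cons b S (suc n) = S n

true≢false : true ≢ false
true≢false ()

bit-zero : ∀ k → bit 0 k ≡ false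
bit-zero zero    = refl
bit-zero (suc k) = bit-zero k

bit⇒< : ∀ b k → bit b k ≡ true → k < b
bit⇒< zero    k       k∈b = ⊥-elim (true≢false (trans (sym k∈b) (bit-zero k)))
bit⇒< (suc b) zero    _   = s≤s z≤n
bit⇒< (suc b) (suc k) k∈b =
  ≤-<-trans (bit⇒< (suc b / 2) k k∈b) (m/n<m (suc b) 2 (s≤s (s≤s z≤n)))

ss/2 : ∀ x → suc (suc x) / 2 ≡ suc (x / 2)
ss/2 x = m/n≡1+[m∸n]/n {suc (suc x)} {2} (s≤s (s≤s z≤n))

double : ℕ → ℕ
double zero    = zero
double (suc n) = suc (suc (double n))

bit-double-zero : ∀ b → bit (double b) zero ≡ false
bit-double-zero zero    = refl
bit-double-zero (suc b) = bit-double-zero b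

double/2 : ∀ b → double b / 2 ≡ b
double/2 zero    = refl
double/2 (suc b) = trans (ss/2 (double b)) (cong suc (double/2 b))

bit-double-suc : ∀ b k → bit (double b) (suc k) ≡ bit b k
bit-double-suc b k = cong (λ z → bit z k) (double/2 b)

IsFull : Family
IsFull T = ∀ n → T n ≡ true

reduction-to-full-not-injective : ∀ {𝒳 f S S′} → Reduces 𝒳 IsFull f →
  𝒳 S → 𝒳 S′ → ¬ S ≐ S′ → ¬ OneToOne f
reduction-to-full-not-injective {S = S} {S′} red x x′ S≢S′ inj =
  S≢S′ (inj S S′ λ n → trans (Equivalence.to (red S) x n)
                             (sym (Equivalence.to (red S′) x′ n)))

Infinite : Family → Set
Infinite 𝒳 = ∀ L → Σ Sub λ S → 𝒳 S × ¬ Any (S ≐_) L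

-- A reduction of an infinite 𝒳 to {ℕ} has the infinite fibre 𝒳 over ℕ.
reduction-to-full-not-finite-to-one : ∀ {𝒳 f} → Infinite 𝒳 →
  Reduces 𝒳 IsFull f → ¬ FiniteToOne f
reduction-to-full-not-finite-to-one inf red fto with fto full
... | L , fibre⊆L with inf L
...   | S , x , S∉L = S∉L (fibre⊆L S (Equivalence.to (red S) x))

-- the i-th set of a list (empty beyond its end)
nth : List Sub → ℕ → Sub
nth []      _       = λ _ → false
nth (X ∷ L) zero    = X
nth (X ∷ L) (suc i) = nth L i

diagonal : List Sub → Sub
diagonal L a = not (nth L a a)

∈⇒nth : ∀ {S} L → Any (S ≐_) L → Σ ℕ λ i → S ≐ nth L i
∈⇒nth (X ∷ L) (here S≐X) = 0 , S≐X
∈⇒nth (X ∷ L) (there S∈L) with ∈⇒nth L S∈L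
... | i , S≐L[i] = suc i , S≐L[i]

not-fixed : ∀ b → not b ≢ b
not-fixed true  ()
not-fixed false ()

-- The diagonal differs from the i-th set at i.
diagonal∉ : ∀ L → ¬ Any (diagonal L ≐_) L
diagonal∉ L d∈L with ∈⇒nth L d∈L
... | i , d≐L[i] = not-fixed (nth L i i) (d≐L[i] i)

Everything : Family
Everything _ = ⊤

everything-infinite : Infinite Everything
everything-infinite L = diagonal L , tt , diagonal∉ L

-- Every constant map is continuous: 𝓑_∅ = 𝒫ℕ is a neighbourhood of X.
const-continuous : ∀ T → Continuous (λ _ → T)
const-continuous T b X T∈𝓑b =
  0 , (λ k k∈∅ → ⊥-elim (true≢false (trans (sym k∈∅) (bit-zero k)))) , (λ _ _ → T∈𝓑b)

-- For value ℕ every pair (A, B) qualifies, so the program 0 witnesses c.e.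
const-full-effective : Effective (λ _ → full)
const-full-effective = zer , λ a b → mk⇔ (λ _ → 0 , e-zer) (λ _ _ _ _ _ → refl)

const-full-reduces : Reduces Everything IsFull (λ _ → full)
const-full-reduces S = mk⇔ (λ _ _ → refl) (λ _ → tt)

shift : Sub → Sub
shift S n = S (suc n)

ContainsPositives : Family
ContainsPositives S = ∀ n → S (suc n) ≡ true

shift-reduces : Reduces ContainsPositives IsFull shift
shift-reduces S = mk⇔ (λ S⊇ℕ⁺ → S⊇ℕ⁺) (λ S⊇ℕ⁺ → S⊇ℕ⁺)

shift-finite-to-one : FiniteToOne shift
shift-finite-to-one T = cons false T ∷ cons true T ∷ [] , fibre
  where
  fibre : ∀ S → shift S ≐ T → Any (S ≐_) (cons false T ∷ cons true T ∷ [])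
  fibre S shiftS≐T with S zero in S0
  ... | false = here      (λ { zero → S0 ; (suc n) → shiftS≐T n })
  ... | true  = there (here (λ { zero → S0 ; (suc n) → shiftS≐T n }))

-- shift⁻¹(𝓑_{D b}) contains the neighbourhood 𝓑_{D b + 1} = 𝓑_{D (double b)}.
shift-continuous : Continuous shift
shift-continuous b X b⊆shiftX = double b , b+1⊆X , λ Y b+1⊆Y k k∈b →
  b+1⊆Y (suc k) (trans (bit-double-suc b k) k∈b)
  where
  b+1⊆X : InB (double b) X
  b+1⊆X zero    0∈ = ⊥-elim (true≢false (trans (sym 0∈) (bit-double-zero b)))
  b+1⊆X (suc k) k∈ = b⊆shiftX k (trans (sym (bit-double-suc b k)) k∈)

-- For a monotone f, f(𝓑_A) ⊆ 𝓑_B iff B ⊆ f(A): the least member of 𝓑_A is A.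
monotone-mapsInto : ∀ f → (∀ X Y → X ⊆ Y → f X ⊆ f Y) →
  ∀ a b → MapsInto f a b ⇔ (D b ⊆ f (D a))
monotone-mapsInto f mono a b = mk⇔
  (λ maps → maps (D a) (λ _ k∈a → k∈a))
  (λ b⊆fa Y a⊆Y k k∈b → mono (D a) Y a⊆Y k (b⊆fa k k∈b))

shift-mapsInto : ∀ a b → MapsInto shift a b ⇔ (D b ⊆ D (a / 2))
shift-mapsInto = monotone-mapsInto shift (λ X Y X⊆Y k → X⊆Y (suc k))

mutual
  eval-deterministic : ∀ {n} {e : PR n} {xs v w} → Eval e xs v → Eval e xs w → v ≡ w
  eval-deterministic e-zer e-zer = refl
  eval-deterministic e-succ e-succ = refl
  eval-deterministic e-proj e-proj = refl
  eval-deterministic (e-comp gs f) (e-comp gs′ f′) with evalAll-deterministic gs gs′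
  ... | refl = eval-deterministic f f′
  eval-deterministic (e-prec0 g) (e-prec0 g′) = eval-deterministic g g′
  eval-deterministic (e-precS r h) (e-precS r′ h′) with eval-deterministic r r′
  ... | refl = eval-deterministic h h′
  eval-deterministic (e-mu {y = y} z below) (e-mu {y = y′} z′ below′) with <-cmp y y′
  ... | tri≈ _ y≡y′ _ = y≡y′
  ... | tri< y<y′ _ _ = ⊥-elim (zero-and-suc z (below′ y y<y′))
  ... | tri> _ _ y′<y = ⊥-elim (zero-and-suc z′ (below y′ y′<y))

  zero-and-suc : ∀ {n} {f : PR (suc n)} {xs y} →
    Eval f (y ∷ xs) 0 → ¬ (Σ ℕ λ w → Eval f (y ∷ xs) (suc w))
  zero-and-suc z (w , s) with eval-deterministic z s
  ... | ()

  evalAll-deterministic : ∀ {n m} {gs : Vec (PR n) m} {xs vs ws} →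
    EvalAll gs xs vs → EvalAll gs xs ws → vs ≡ ws
  evalAll-deterministic [] [] = refl
  evalAll-deterministic (p ∷ ps) (q ∷ qs)
    with eval-deterministic p q | evalAll-deterministic ps qs
  ... | refl | refl = refl

-- A relation decided by a total program (output 0 meaning "yes") is c.e.:
-- μ searches for a dummy argument on which the program returns 0.
zero-test-ce : ∀ (R : ℕ → ℕ → Set) (e : PR 2) (g : ℕ → ℕ → ℕ) →
  (∀ a b → Eval e (a ∷ b ∷ []) (g a b)) → (∀ a b → R a b ⇔ (g a b ≡ 0)) → CE2 R
zero-test-ce R e g computes decides =
  mu (comp e (proj (fs f0) ∷ proj (fs (fs f0)) ∷ [])) , λ a b → mk⇔
    (λ r → 0 , e-mu (e-comp (e-proj ∷ e-proj ∷ [])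
               (subst (Eval e (a ∷ b ∷ [])) (Equivalence.to (decides a b) r) (computes a b)))
             (λ _ ()))
    (λ { (_ , e-mu (e-comp (e-proj ∷ e-proj ∷ []) e0) _) →
         Equivalence.from (decides a b) (sym (eval-deterministic e0 (computes a b))) })

b2n : Bool → ℕ
b2n true  = 1
b2n false = 0

oneP : PR 0
oneP = comp succ (zer ∷ [])

isZero : ℕ → ℕ
isZero zero    = 1
isZero (suc _) = 0

isZeroP : PR 1
isZeroP = prec oneP zer

isZeroP-computes : ∀ x → Eval isZeroP (x ∷ []) (isZero x)
isZeroP-computes zero    = e-prec0 (e-comp (e-zer ∷ []) e-succ)
isZeroP-computes (suc x) = e-precS (isZeroP-computes x) e-zer

parity : ℕ → ℕ
parity zero    = 0
parity (suc x) = isZero (parity x)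

parityP : PR 1
parityP = prec zer (comp isZeroP (proj (fs f0) ∷ []))

parityP-computes : ∀ x → Eval parityP (x ∷ []) (parity x)
parityP-computes zero    = e-prec0 e-zer
parityP-computes (suc x) =
  e-precS (parityP-computes x) (e-comp (e-proj ∷ []) (isZeroP-computes (parity x)))

addP : PR 2
addP = prec (proj f0) (comp succ (proj (fs f0) ∷ []))

addP-computes : ∀ x y → Eval addP (x ∷ y ∷ []) (x + y)
addP-computes zero    y = e-prec0 e-proj
addP-computes (suc x) y = e-precS (addP-computes x y) (e-comp (e-proj ∷ []) e-succ)

halve : ℕ → ℕ
halve zero    = 0
halve (suc x) = parity x + halve x

halveP : PR 1
halveP = prec zer (comp addP (comp parityP (proj f0 ∷ []) ∷ proj (fs f0) ∷ []))

halveP-computes : ∀ x → Eval halveP (x ∷ []) (halve x)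
halveP-computes zero    = e-prec0 e-zer
halveP-computes (suc x) = e-precS (halveP-computes x)
  (e-comp (e-comp (e-proj ∷ []) (parityP-computes x) ∷ e-proj ∷ [])
          (addP-computes (parity x) (halve x)))

halveIter : ℕ → ℕ → ℕ
halveIter zero    x = x
halveIter (suc k) x = halve (halveIter k x)

halveIterP : PR 2
halveIterP = prec (proj f0) (comp halveP (proj (fs f0) ∷ []))

halveIterP-computes : ∀ k x → Eval halveIterP (k ∷ x ∷ []) (halveIter k x)
halveIterP-computes zero    x = e-prec0 e-proj
halveIterP-computes (suc k) x = e-precS (halveIterP-computes k x)
  (e-comp (e-proj ∷ []) (halveP-computes (halveIter k x)))

bitℕ : ℕ → ℕ → ℕ
bitℕ k x = parity (halveIter k x)

bitP : PR 2
bitP = comp parityP (halveIterP ∷ [])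

bitP-computes : ∀ k x → Eval bitP (k ∷ x ∷ []) (bitℕ k x)
bitP-computes k x = e-comp (halveIterP-computes k x ∷ []) (parityP-computes (halveIter k x))

and : ℕ → ℕ → ℕ
and zero    y = 0
and (suc _) y = y

andP : PR 2
andP = prec zer (proj (fs (fs f0)))

andP-computes : ∀ x y → Eval andP (x ∷ y ∷ []) (and x y)
andP-computes zero    y = e-prec0 e-zer
andP-computes (suc x) y = e-precS (andP-computes x y) e-proj

missingAt : ℕ → ℕ → ℕ → ℕ
missingAt k c b = and (bitℕ k b) (isZero (bitℕ k c))

missingAtP : PR 3
missingAtP = comp andP
  ( comp bitP (proj f0 ∷ proj (fs (fs f0)) ∷ [])
  ∷ comp isZeroP (comp bitP (proj f0 ∷ proj (fs f0) ∷ []) ∷ []) ∷ [])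

missingAtP-computes : ∀ k c b → Eval missingAtP (k ∷ c ∷ b ∷ []) (missingAt k c b)
missingAtP-computes k c b = e-comp
  ( e-comp (e-proj ∷ e-proj ∷ []) (bitP-computes k b)
  ∷ e-comp (e-comp (e-proj ∷ e-proj ∷ []) (bitP-computes k c) ∷ [])
           (isZeroP-computes (bitℕ k c)) ∷ [])
  (andP-computes (bitℕ k b) (isZero (bitℕ k c)))

missing : ℕ → ℕ → ℕ → ℕ
missing zero    c b = 0
missing (suc k) c b = missingAt k c b + missing k c b

missingP : PR 3
missingP = prec zer (comp addP
  ( comp missingAtP (proj f0 ∷ proj (fs (fs f0)) ∷ proj (fs (fs (fs f0))) ∷ [])
  ∷ proj (fs f0) ∷ []))

missingP-computes : ∀ N c b → Eval missingP (N ∷ c ∷ b ∷ []) (missing N c b)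
missingP-computes zero    c b = e-prec0 e-zer
missingP-computes (suc k) c b = e-precS (missingP-computes k c b)
  (e-comp (e-comp (e-proj ∷ e-proj ∷ e-proj ∷ []) (missingAtP-computes k c b) ∷ e-proj ∷ [])
          (addP-computes (missingAt k c b) (missing k c b)))

isZero-involutive : ∀ c → isZero (isZero (b2n c)) ≡ b2n c
isZero-involutive true  = refl
isZero-involutive false = refl

parity-correct : ∀ x → parity x ≡ b2n (bit x 0)
parity-correct zero          = refl
parity-correct (suc zero)    = refl
parity-correct (suc (suc x)) =
  trans (cong (λ p → isZero (isZero p)) (parity-correct x)) (isZero-involutive (bit x 0))

-- of two consecutive numbers exactly one is odd
parity-sum : ∀ c y → isZero (b2n c) + (b2n c + y) ≡ suc y
parity-sum true  y = refl
parity-sum false y = refl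

halve-correct : ∀ x → halve x ≡ x / 2
halve-correct zero          = refl
halve-correct (suc zero)    = refl
halve-correct (suc (suc x)) = begin
  isZero (parity x) + (parity x + halve x)
    ≡⟨ cong (λ p → isZero p + (p + halve x)) (parity-correct x) ⟩
  isZero (b2n (bit x 0)) + (b2n (bit x 0) + halve x)
    ≡⟨ parity-sum (bit x 0) (halve x) ⟩
  suc (halve x)
    ≡⟨ cong suc (halve-correct x) ⟩
  suc (x / 2)
    ≡⟨ sym (ss/2 x) ⟩
  suc (suc x) / 2 ∎

halveIter-halve : ∀ k x → halveIter k (halve x) ≡ halveIter (suc k) x
halveIter-halve zero    x = refl
halveIter-halve (suc k) x = cong halve (halveIter-halve k x)

bitℕ-correct : ∀ k x → bitℕ k x ≡ b2n (bit x k)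
bitℕ-correct zero    x = parity-correct x
bitℕ-correct (suc k) x = begin
  parity (halveIter (suc k) x) ≡⟨ cong parity (sym (halveIter-halve k x)) ⟩
  bitℕ k (halve x)             ≡⟨ bitℕ-correct k (halve x) ⟩
  b2n (bit (halve x) k)        ≡⟨ cong (λ z → b2n (bit z k)) (halve-correct x) ⟩
  b2n (bit (x / 2) k)          ∎

missingAt-correct : ∀ k c b → missingAt k c b ≡ b2n (bit b k ∧ not (bit c k))
missingAt-correct k c b rewrite bitℕ-correct k b | bitℕ-correct k c =
  and-correct (bit b k) (bit c k)
  where
  and-correct : ∀ p q → and (b2n p) (isZero (b2n q)) ≡ b2n (p ∧ not q)
  and-correct true  true  = refl
  and-correct true  false = refl
  and-correct false q     = refl

missingAt-zero : ∀ k c b → missingAt k c b ≡ 0 → bit b k ≡ true → bit c k ≡ true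
missingAt-zero k c b none k∈b with bit c k | missingAt-correct k c b
... | true  | _ = refl
... | false | counted rewrite k∈b with trans (sym counted) none
...   | ()

+≡0 : ∀ x y → x + y ≡ 0 → x ≡ 0 × y ≡ 0
+≡0 zero y y≡0 = refl , y≡0

no-missing⇒⊆ : ∀ N c b → missing N c b ≡ 0 → ∀ k → k < N → bit b k ≡ true → bit c k ≡ true
no-missing⇒⊆ (suc N) c b none k (s≤s k≤N) k∈b with +≡0 (missingAt N c b) _ none
... | noneAt , noneBelow with m≤n⇒m<n∨m≡n k≤N
...   | inj₁ k<N  = no-missing⇒⊆ N c b noneBelow k k<N k∈b
...   | inj₂ refl = missingAt-zero k c b noneAt k∈b

⊆⇒no-missing : ∀ N c b → D b ⊆ D c → missing N c b ≡ 0
⊆⇒no-missing zero    c b b⊆c = refl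
⊆⇒no-missing (suc N) c b b⊆c
  rewrite ⊆⇒no-missing N c b b⊆c | missingAt-correct N c b with bit b N in N∈b
... | false = refl
... | true rewrite b⊆c N N∈b = refl

-- Since D b ⊆ {0, …, b − 1}, inclusion is decided by counting below b.
⊆⇔no-missing : ∀ c b → (D b ⊆ D c) ⇔ (missing b c b ≡ 0)
⊆⇔no-missing c b = mk⇔ (⊆⇒no-missing b c b)
  (λ none k k∈b → no-missing⇒⊆ b c b none k (bit⇒< b k k∈b) k∈b)

shiftTest : ℕ → ℕ → ℕ
shiftTest a b = missing b (a / 2) b

shiftTestP : PR 2
shiftTestP = comp missingP (proj (fs f0) ∷ comp halveP (proj f0 ∷ []) ∷ proj (fs f0) ∷ [])

shiftTestP-computes : ∀ a b → Eval shiftTestP (a ∷ b ∷ []) (shiftTest a b)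
shiftTestP-computes a b = subst (λ c → Eval shiftTestP (a ∷ b ∷ []) (missing b c b))
  (halve-correct a)
  (e-comp (e-proj ∷ e-comp (e-proj ∷ []) (halveP-computes a) ∷ e-proj ∷ [])
          (missingP-computes b (halve a) b))

shift-effective : Effective shift
shift-effective = zero-test-ce (MapsInto shift) shiftTestP shiftTest shiftTestP-computes
  λ a b → ⇔-trans (shift-mapsInto a b) (⊆⇔no-missing (a / 2) b)

everything≤eW : Everything ≤eW IsFull
everything≤eW = (λ _ → full) , const-continuous full , const-full-effective , const-full-reduces

everything≤W : Everything ≤W IsFull
everything≤W with everything≤eW
... | f , cont , _ , red = f , cont , red

positives≤eFW : ContainsPositives ≤eFW IsFull
positives≤eFW = shift , shift-continuous , shift-effective , shift-finite-to-one , shift-reduces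

positives≤FW : ContainsPositives ≤FW IsFull
positives≤FW with positives≤eFW
... | f , cont , _ , fto , red = f , cont , fto , red

-- ℕ and ℕ ∖ {0} are distinct members of both 𝒫ℕ and ContainsPositives.
full≢cons : ¬ full ≐ cons false full
full≢cons full≐ = true≢false (full≐ 0)

everything-not-finite-to-one : ∀ {f} → Reduces Everything IsFull f → ¬ FiniteToOne f
everything-not-finite-to-one = reduction-to-full-not-finite-to-one everything-infinite

everything-not-injective : ∀ {f} → Reduces Everything IsFull f → ¬ OneToOne f
everything-not-injective red = reduction-to-full-not-injective red tt tt full≢cons

positives-not-injective : ∀ {f} → Reduces ContainsPositives IsFull f → ¬ OneToOne f
positives-not-injective red =
  reduction-to-full-not-injective red (λ _ → refl) (λ _ → refl) full≢cons

proposition3p3 : (Inequiv _≤W_ _≤FW_ × Inequiv _≤W_ _≤1W_ × Inequiv _≤FW_ _≤1W_)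
    × (Inequiv _≤eW_ _≤eFW_ × Inequiv _≤eW_ _≤e1W_ × Inequiv _≤eFW_ _≤e1W_)
proposition3p3 =
  ( inequiv {_≤W_} {_≤FW_} Everything IsFull everything≤W
      (λ { (_ , _ , fto , red) → everything-not-finite-to-one red fto })
  , inequiv {_≤W_} {_≤1W_} Everything IsFull everything≤W
      (λ { (_ , _ , inj , red) → everything-not-injective red inj })
  , inequiv {_≤FW_} {_≤1W_} ContainsPositives IsFull positives≤FW
      (λ { (_ , _ , inj , red) → positives-not-injective red inj }) )
  , ( inequiv {_≤eW_} {_≤eFW_} Everything IsFull everything≤eW
      (λ { (_ , _ , _ , fto , red) → everything-not-finite-to-one red fto })
  , inequiv {_≤eW_} {_≤e1W_} Everything IsFull everything≤eW
      (λ { (_ , _ , _ , inj , red) → everything-not-injective red inj })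
  , inequiv {_≤eFW_} {_≤e1W_} ContainsPositives IsFull positives≤eFW
      (λ { (_ , _ , _ , inj , red) → positives-not-injective red inj }) )
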